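{- The map $\mathsf{MoToNe}$ from Motzkin trees to neutral normal forms, defined in the context, is injective.
   Context: Lambda terms in de Bruijn notation: $M ::= \underline{0} \mid S\,n \mid \lambda M \mid M\,M$ with indices $n ::= \underline{0}\mid S\,n$ (not necessarily closed). Normal forms $\mathcal{N}$ and neutral normal forms $\mathcal{M}$ are given by the grammar $\mathcal{N} ::= \mathcal{M} \mid \lambda\mathcal{N}$, $\mathcal{M} ::= \mathcal{M}\,\mathcal{N} \mid d$ where $d$ ranges over de Bruijn indices. A Motzkin tree is a finite rooted plane tree in which each node has $0$, $1$ (unary node) or $2$ (binary node, with ordered left and right subtrees) children. Every Motzkin tree $T$ is of exactly one of the forms: (a) a unary path $u_n$, i.e. a chain of $n\ge1$ nodes each of which is unary except the last, which is a leaf; (b) a binary root with left subtree $t$ and right subtree $t'$; (c) a chain of $n \ge 1$ unary nodes, the child of the last of which is a binary node with left subtree $t$ and right subtree $t'$. Define $\mathsf{MoToNe}$ recursively: in case (a) $\mathsf{MoToNe}(u_n) = S^{n-1}\underline{0}$; in case (b) $\mathsf{MoToNe}(T) = \mathsf{MoToNe}(t)\,\mathsf{MoToNe}(t')$; in case (c) $\mathsf{MoToNe}(T) = \mathsf{MoToNe}(t)\,\big(\lambda^n\,\mathsf{MoToNe}(t')\big)$, where $\lambda^n$ denotes $n$ nested abstractions. -}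

module Defs where

open import Data.Nat using (ℕ; zero; suc)

data Index : Set where
  𝟘 : Index
  S : Index → Index

data Term : Set where
  var : Index → Term
  lam : Term → Term
  app : Term → Term → Term

mutual
  data IsNF : Term → Set where
    ne  : ∀ {M} → IsNe M → IsNF M
    lam : ∀ {M} → IsNF M → IsNF (lam M)

  data IsNe : Term → Set where
    var : ∀ d → IsNe (var d)
    app : ∀ {M N} → IsNe M → IsNF N → IsNe (app M N)

data Motzkin : Set where
  leaf   : Motzkin
  unary  : Motzkin → Motzkin
  binary : Motzkin → Motzkin → Motzkin

Sⁿ0 : ℕ → Index
Sⁿ0 zero    = 𝟘
Sⁿ0 (suc k) = S (Sⁿ0 k)

lamⁿ : ℕ → Term → Term
lamⁿ zero    M = M
lamⁿ (suc k) M = lam (lamⁿ k M)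

-- MoToNe.  peel k T  computes MoToNe of the tree consisting of k unary
-- nodes on top of T:
--   (a) k unary nodes above a leaf is the unary path u_(k+1) ↦ S^k 0
--   (b) k = 0, T binary with subtrees t, t' ↦ MoToNe t · MoToNe t'
--   (c) k ≥ 1, T binary with subtrees t, t' ↦ MoToNe t · (λ^k MoToNe t')
mutual
  MoToNe : Motzkin → Term
  MoToNe T = peel zero T

  peel : ℕ → Motzkin → Term
  peel k       leaf           = var (Sⁿ0 k)
  peel k       (unary T)      = peel (suc k) T
  peel zero    (binary t t')  = app (MoToNe t) (MoToNe t')
  peel (suc k) (binary t t')  = app (MoToNe t) (lamⁿ (suc k) (MoToNe t'))

-- MoToNe is determined by peel k T, which reads off the whole tree: a variable
-- gives the length k of the unary chain above a leaf, and an application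
-- M · λᵏ N gives the left subtree from M, and (since N is never an abstraction)
-- the chain length k together with the right subtree from λᵏ N.
module Submission where

open import Defs
open import Data.Nat using (ℕ; zero; suc)
open import Data.Product using (_×_; _,_)
open import Relation.Nullary using (contradiction)
open import Relation.Binary.PropositionalEquality using (_≡_; _≢_; refl; sym; trans; cong)

unaryⁿ : ℕ → Motzkin → Motzkin
unaryⁿ zero    T = T
unaryⁿ (suc k) T = unaryⁿ k (unary T)

S-injective : {i j : Index} → S i ≡ S j → i ≡ j
S-injective refl = refl

var-injective : {i j : Index} → Term.var i ≡ Term.var j → i ≡ j
var-injective refl = refl

lam-injective : {M N : Term} → lam M ≡ lam N → M ≡ N
lam-injective refl = refl

app-injective : {M M′ N N′ : Term} → app M N ≡ app M′ N′ → M ≡ M′ × N ≡ N′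
app-injective refl = refl , refl

Sⁿ0-injective : ∀ a b → Sⁿ0 a ≡ Sⁿ0 b → a ≡ b
Sⁿ0-injective zero    zero    _ = refl
Sⁿ0-injective (suc a) (suc b) e = cong suc (Sⁿ0-injective a b (S-injective e))

lamⁿ-injective : ∀ a b {M N : Term} → (∀ {X : Term} → M ≢ lam X) → (∀ {X : Term} → N ≢ lam X) →
                 lamⁿ a M ≡ lamⁿ b N → a ≡ b × M ≡ N
lamⁿ-injective zero    zero    _  _  e = refl , e
lamⁿ-injective zero    (suc b) M≢ _  e = contradiction e M≢
lamⁿ-injective (suc a) zero    _  N≢ e = contradiction (sym e) N≢
lamⁿ-injective (suc a) (suc b) M≢ N≢ e
  with lamⁿ-injective a b M≢ N≢ (lam-injective e)
... | refl , M≡N = refl , M≡N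

peel≢lam : ∀ k T {X : Term} → peel k T ≢ lam X
peel≢lam k       (unary T)      = peel≢lam (suc k) T
peel≢lam k       leaf         ()
peel≢lam zero    (binary t t′) ()
peel≢lam (suc k) (binary t t′) ()

peel-binary : ∀ k t t′ → peel k (binary t t′) ≡ app (MoToNe t) (lamⁿ k (MoToNe t′))
peel-binary zero    t t′ = refl
peel-binary (suc k) t t′ = refl

peel-injective : ∀ k T k′ T′ → peel k T ≡ peel k′ T′ → unaryⁿ k T ≡ unaryⁿ k′ T′
peel-injective k (unary T)    k′ T′          e = peel-injective (suc k) T k′ T′ e
peel-injective k leaf         k′ (unary T′) e = peel-injective k leaf (suc k′) T′ e
peel-injective k (binary t u) k′ (unary T′) e = peel-injective k (binary t u) (suc k′) T′ e
peel-injective k leaf k′ leaf e with Sⁿ0-injective k k′ (var-injective e)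
... | refl = refl
peel-injective k       leaf         zero     (binary t′ u′) ()
peel-injective k       leaf         (suc k′) (binary t′ u′) ()
peel-injective zero    (binary t u) k′       leaf           ()
peel-injective (suc k) (binary t u) k′       leaf           ()
peel-injective k (binary t u) k′ (binary t′ u′) e =
  binary-injective (app-injective (trans (sym (peel-binary k t u)) (trans e (peel-binary k′ t′ u′))))
  where
  binary-injective : MoToNe t ≡ MoToNe t′ × lamⁿ k (MoToNe u) ≡ lamⁿ k′ (MoToNe u′) →
                     unaryⁿ k (binary t u) ≡ unaryⁿ k′ (binary t′ u′)
  binary-injective (t≅t′ , λᵏu≡λᵏ′u′)
    with lamⁿ-injective k k′ (peel≢lam zero u) (peel≢lam zero u′) λᵏu≡λᵏ′u′
  ... | refl , u≅u′
    with peel-injective zero t zero t′ t≅t′ | peel-injective zero u zero u′ u≅u′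
  ... | refl | refl = refl

proposition4 : (T T′ : Motzkin) → MoToNe T ≡ MoToNe T′ → T ≡ T′
proposition4 T T′ = peel-injective zero T zero T′
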